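{- Let $a=\sum_{e\in E}\lambda_e\,\bullet_e\in\widehat{\mathcal{PL}}(E)$ with scalars $\lambda_e\in K$, and let $G_a\colon\mathcal{PL}(\bullet)\to\widehat{\mathcal{PL}}(E)$ be the unique pre-Lie algebra homomorphism with $G_a(\bullet)=a$. Then for every (undecorated) planar rooted tree $\tau$, $$G_a\big(\overline{\Psi}(\tau)\big)=\sum_{\delta\colon V(\tau)\to E}\Big(\prod_{v\in V(\tau)}\lambda_{\delta(v)}\Big)\,\overline{\Psi}(\tau_\delta),$$ where $\tau_\delta$ is the planar tree $\tau$ with vertices decorated according to $\delta$.
   Context: $K$ is the ground field. $E=\bigsqcup_{i\ge1}E_i$ is a graded set of generators with each $E_i$ finite and $|e|=i$ for $e\in E_i$. $\mathcal{PL}(E)$ is the span of (non-planar) rooted trees with vertices decorated by $E$, with grafting $s\to t=\sum_{v\in V(t)}s\circ_v t$ (attach the root of $s$ to vertex $v$ of $t$); it is the free pre-Lie algebra on the one-vertex trees $\bullet_e$, $e\in E$. The degree of a decorated tree is the sum of the degrees of its decorations, and $\widehat{\mathcal{PL}}(E)$ is the completion with respect to this degree (a pre-Lie algebra under grafting). $\mathcal{PL}(\bullet)$ is the undecorated version (free pre-Lie algebra on one generator $\bullet$). For a planar rooted tree (decorated or not), written uniquely as $B_+(\tau_1\cdots\tau_k)$ with root (decoration $e$ in the decorated case), $\overline{\Psi}$ is defined by $\overline{\Psi}(\bullet_e)=\bullet_e$ and $\overline{\Psi}(B^{e}_+(\tau_1\cdots\tau_k))=\overline{\Psi}(\tau_1)\to(\overline{\Psi}(\tau_2)\to(\cdots\to(\overline{\Psi}(\tau_k)\to\bullet_e)\cdots))$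 (undecorated: same with $\bullet$). -}

module Defs where

open import Level using (Level)
open import Algebra.Bundles using (CommutativeRing)
open import Data.Bool using (Bool; true; false; _∧_; if_then_else_)
open import Data.Nat as ℕ using (ℕ; zero; suc; _∸_)
open import Data.Fin as Fin using (Fin)
import Data.Fin.Properties as FinP
open import Data.Maybe using (Maybe; just; nothing)
open import Data.Unit using (⊤; tt)
open import Data.Product using (Σ; _×_; _,_; proj₁; proj₂; ∃)
open import Data.Product.Properties using (≡-dec)
open import Data.List using (List; []; _∷_; _++_; map; concatMap; upTo; allFin; filter)
open import Relation.Nullary using (¬_; does)
open import Relation.Binary.PropositionalEquality using (_≡_)
open import Relation.Binary.Definitions using (DecidableEquality)

-- Planar rooted trees with vertices decorated by D
-- (node d ts = B_+^d(t_1 ... t_k); undecorated trees are PTree ⊤).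

data PTree (D : Set) : Set where
  node : D → List (PTree D) → PTree D

module Trees {D : Set} where

  -- s ∘_v t for all vertices v of t (s attached as a new child of v;
  -- as trees are non-planar the position among the children is irrelevant).
  mutual
    graftT : PTree D → PTree D → List (PTree D)
    graftT s (node d ts) = node d (s ∷ ts) ∷ map (node d) (graftL s ts)

    graftL : PTree D → List (PTree D) → List (List (PTree D))
    graftL s [] = []
    graftL s (t ∷ ts) = map (_∷ ts) (graftT s t) ++ map (t ∷_) (graftL s ts)

  module Degree (w : D → ℕ) where
    mutual
      deg : PTree D → ℕ
      deg (node d ts) = w d ℕ.+ degL ts

      degL : List (PTree D) → ℕ
      degL [] = 0
      degL (t ∷ ts) = deg t ℕ.+ degL ts

  -- isomorphism of (non-planar) rooted trees: equality after forgetting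
  -- the planar order of children (decided by greedy matching of children).
  module Iso (_≟_ : DecidableEquality D) where
    mutual
      isoT : PTree D → PTree D → Bool
      isoT (node d ts) (node e us) = does (d ≟ e) ∧ isoL ts us

      isoL : List (PTree D) → List (PTree D) → Bool
      isoL [] [] = true
      isoL [] (_ ∷ _) = false
      isoL (t ∷ ts) us = isoL′ ts (removeIso t us)

      isoL′ : List (PTree D) → Maybe (List (PTree D)) → Bool
      isoL′ ts nothing = false
      isoL′ ts (just us) = isoL ts us

      removeIso : PTree D → List (PTree D) → Maybe (List (PTree D))
      removeIso t [] = nothing
      removeIso t (u ∷ us) = if isoT t u then just us else consM u (removeIso t us)

      consM : PTree D → Maybe (List (PTree D)) → Maybe (List (PTree D))
      consM u nothing = nothing
      consM u (just us) = just (u ∷ us)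

-- PL(D): finite formal K-linear combinations of planar trees, compared
-- as elements of the span of NON-planar trees (coefficient of each
-- isomorphism class).

module Sums {c ℓ} (R : CommutativeRing c ℓ) {D : Set} (_≟D_ : DecidableEquality D) where
  open CommutativeRing R renaming (Carrier to K)
  open Trees {D}
  open Iso _≟D_

  FSum : Set c
  FSum = List (K × PTree D)

  coeff : FSum → PTree D → K
  coeff [] u = 0#
  coeff ((k , t) ∷ x) u = if isoT t u then k + coeff x u else coeff x u

  _≋_ : FSum → FSum → Set ℓ
  x ≋ y = ∀ u → coeff x u ≈ coeff y u

  _⊙_ : K → FSum → FSum
  k ⊙ x = map (λ p → (k * proj₁ p , proj₂ p)) x

  _⇒_ : FSum → FSum → FSum
  x ⇒ y = concatMap (λ p → concatMap (λ q →
            map (λ v → (proj₁ p * proj₁ q , v)) (graftT (proj₂ p) (proj₂ q))) y) x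

  -- Ψ̄(B_+^d(τ_1 ... τ_k)) = Ψ̄(τ_1) → (Ψ̄(τ_2) → (... → (Ψ̄(τ_k) → •_d)))
  mutual
    Ψ̄ : PTree D → FSum
    Ψ̄ (node d ts) = Ψ̄L ts ((1# , node d []) ∷ [])

    Ψ̄L : List (PTree D) → FSum → FSum
    Ψ̄L [] acc = acc
    Ψ̄L (t ∷ ts) acc = Ψ̄ t ⇒ Ψ̄L ts acc

-- The concrete setting: E = ⊔_{i ≥ 1} E_i with E_{i+1} = Fin (N i),
-- i.e. a decoration (i , j) has degree suc i.

module Setup {c ℓ} (R : CommutativeRing c ℓ) (N : ℕ → ℕ) where
  open CommutativeRing R public renaming (Carrier to K)

  IsField : Set (c Level.⊔ ℓ)
  IsField = (¬ (1# ≈ 0#)) × (∀ x → ¬ (x ≈ 0#) → ∃ λ y → x * y ≈ 1#)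

  E : Set
  E = Σ ℕ (λ i → Fin (N i))

  _≟E_ : DecidableEquality E
  _≟E_ = ≡-dec ℕ._≟_ FinP._≟_

  ∣_∣ : E → ℕ
  ∣ (i , _) ∣ = suc i

  _≟⊤_ : DecidableEquality ⊤
  tt ≟⊤ tt = Relation.Nullary.yes Relation.Binary.PropositionalEquality.refl

  module U = Sums R _≟⊤_
  open U public using () renaming (FSum to PL• ; _≋_ to _≋•_ ; _⊙_ to _⊙•_ ;
                                   _⇒_ to _⇒•_ ; Ψ̄ to Ψ̄•)

  • : PL•
  • = (1# , node tt []) ∷ []

  module S = Sums R _≟E_
  open S using (FSum; coeff; _⊙_; _⇒_) renaming (Ψ̄ to Ψ̄E)
  open Trees.Degree {E} ∣_∣ using (deg)

  -- completion \hat{PL}(E): a series is given by its homogeneous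
  -- components (component d = the degree-d part; only the degree-d
  -- trees in x d are taken into account).
  PLhat : Set c
  PLhat = ℕ → FSum

  homog : ℕ → FSum → FSum
  homog d = filter (λ p → deg (proj₂ p) ℕ.≟ d)

  scoeff : PLhat → PTree E → K
  scoeff x u = coeff (x (deg u)) u

  _≈̂_ : PLhat → PLhat → Set ℓ
  x ≈̂ y = ∀ u → scoeff x u ≈ scoeff y u

  _⊕̂_ : PLhat → PLhat → PLhat
  (x ⊕̂ y) d = x d ++ y d

  _⊙̂_ : K → PLhat → PLhat
  (k ⊙̂ x) d = k ⊙ x d

  _⇒̂_ : PLhat → PLhat → PLhat
  (x ⇒̂ y) d = concatMap (λ i → homog i (x i) ⇒ homog (d ∸ i) (y (d ∸ i))) (upTo (suc d))

  record IsPreLieHom (G : PL• → PLhat) : Set (c Level.⊔ ℓ) where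
    field
      G-cong  : ∀ x y → x ≋• y → G x ≈̂ G y
      G-+     : ∀ x y → G (x ++ y) ≈̂ (G x ⊕̂ G y)
      G-scal  : ∀ k x → G (k ⊙• x) ≈̂ (k ⊙̂ G x)
      G-graft : ∀ x y → G (x ⇒• y) ≈̂ (G x ⇒̂ G y)

  aSeries : (E → K) → PLhat
  aSeries lam zero = []
  aSeries lam (suc i) = map (λ j → (lam (i , j) , node (i , j) [])) (allFin (N i))

  -- all decorations δ : V(τ) → E of a planar tree τ with total degree d,
  -- listed as the decorated trees τ_δ
  mutual
    decsT : PTree ⊤ → ℕ → List (PTree E)
    decsT (node _ ts) d =
      concatMap (λ i → concatMap (λ j → map (node (i , j)) (decsL ts (d ∸ suc i)))
                                 (allFin (N i)))
                (upTo d)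

    decsL : List (PTree ⊤) → ℕ → List (List (PTree E))
    decsL [] zero = [] ∷ []
    decsL [] (suc _) = []
    decsL (t ∷ ts) d =
      concatMap (λ k → concatMap (λ t′ → map (t′ ∷_) (decsL ts (d ∸ k))) (decsT t k))
                (upTo (suc d))

  mutual
    weight : (E → K) → PTree E → K
    weight lam (node e ts) = lam e * weightL lam ts

    weightL : (E → K) → List (PTree E) → K
    weightL lam [] = 1#
    weightL lam (t ∷ ts) = weight lam t * weightL lam ts

  rhs : (E → K) → PTree ⊤ → PLhat
  rhs lam τ d = concatMap (λ σ → weight lam σ ⊙ Ψ̄E σ) (decsT τ d)

module Submission where

-- Since Ψ̄(B₊(τ₁ ⋯ τ_k)) = Ψ̄(τ₁) → (⋯ → (Ψ̄(τ_k) → •)), the homomorphism G turns it into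
-- G(Ψ̄ τ₁) → (⋯ → (G(Ψ̄ τ_k) → a)), and by induction each G(Ψ̄ τᵢ) is already the decorated
-- sum of τᵢ. Expanding this iterated grafting by bilinearity and sorting the decorations of τ
-- by the decoration of the root and the degrees of the subtrees gives the decorated sum of τ;
-- in each degree this is an exchange of summations over a triangle of index pairs.
-- Series are compared coefficientwise on non-planar trees, so the technical core is that
-- grafting respects tree isomorphism: the coefficients of x → y only depend on those of x
-- and y.

open import Defs
open import Algebra.Bundles using (CommutativeRing)
open import Data.Nat using (ℕ)
open import Data.Unit using (⊤; tt)

open import Level using (Level)
open import Data.Bool using (Bool; true; false; if_then_else_)
open import Data.Nat as ℕ using (zero; suc; _∸_)
import Data.Nat.Properties as ℕ
import Algebra.Properties.CommutativeSemigroup ℕ.+-commutativeSemigroup as ℕ+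
open import Data.Maybe using (just)
open import Data.Product using (∃; ∃₂; _×_; _,_; proj₁; proj₂)
open import Data.List using (List; []; _∷_; _++_; map; concatMap; applyUpTo; upTo; allFin)
import Data.List.Properties as List
open import Data.List.Relation.Binary.Pointwise as Pointwise using (Pointwise; []; _∷_)
open import Data.List.Relation.Binary.Permutation.Propositional as ↭ using (_↭_; ↭-sym)
import Data.List.Relation.Binary.Permutation.Propositional.Properties as Perm
open import Data.List.Membership.Propositional using (_∈_)
import Data.List.Membership.Propositional.Properties as ∈
open import Data.List.Relation.Unary.Any using (Any; here; there)
open import Data.List.Relation.Unary.All as All using (All; []; _∷_)
import Data.List.Relation.Unary.All.Properties as All
open import Data.Empty using (⊥-elim)
open import Function using (_∘_)
open import Relation.Nullary using (¬_; does; yes; no)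
open import Relation.Binary.PropositionalEquality as ≡ using (_≡_; cong; cong₂)
open import Relation.Binary.Definitions using (DecidableEquality)

All-map⁺ : ∀ {a b p} {A : Set a} {B : Set b} {P : B → Set p} (f : A → B) {xs} →
           (∀ {x} → x ∈ xs → P (f x)) → All P (map f xs)
All-map⁺ f h = All.map⁺ (All.tabulate h)

All-concatMap⁺ : ∀ {a b p} {A : Set a} {B : Set b} {P : B → Set p} (f : A → List B) {xs} →
                 (∀ {x} → x ∈ xs → All P (f x)) → All P (concatMap f xs)
All-concatMap⁺ f h = All.concat⁺ (All-map⁺ f h)

module _ {A : Set} where

  PermutationModulo : (A → A → Set) → List A → List A → Set
  PermutationModulo R xs ys = ∃ λ zs → Pointwise R xs zs × zs ↭ ys

  module _ {R : A → A → Set} where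

    ↭-Pointwise-commute : ∀ {xs ys zs} → xs ↭ ys → Pointwise R ys zs →
                          ∃ λ ws → Pointwise R xs ws × ws ↭ zs
    ↭-Pointwise-commute ↭.refl rs = _ , rs , ↭.refl
    ↭-Pointwise-commute (↭.prep x p) (r ∷ rs) with ↭-Pointwise-commute p rs
    ... | ws , rs′ , q = _ , r ∷ rs′ , ↭.prep _ q
    ↭-Pointwise-commute (↭.swap x y p) (r₁ ∷ r₂ ∷ rs) with ↭-Pointwise-commute p rs
    ... | ws , rs′ , q = _ , r₂ ∷ r₁ ∷ rs′ , ↭.swap _ _ q
    ↭-Pointwise-commute (↭.trans p q) rs with ↭-Pointwise-commute q rs
    ... | ws , rs₁ , q₁ with ↭-Pointwise-commute p rs₁
    ... | vs , rs₂ , q₂ = vs , rs₂ , ↭.trans q₂ q₁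

    Pointwise⇒PermutationModulo : ∀ {xs ys} → Pointwise R xs ys → PermutationModulo R xs ys
    Pointwise⇒PermutationModulo rs = _ , rs , ↭.refl

    ↭⇒PermutationModulo : (∀ {x} → R x x) → ∀ {xs ys} → xs ↭ ys → PermutationModulo R xs ys
    ↭⇒PermutationModulo R-refl p = _ , Pointwise.refl R-refl , p

    PermutationModulo-∷⁺ : ∀ {x y xs ys} → R x y → PermutationModulo R xs ys →
                           PermutationModulo R (x ∷ xs) (y ∷ ys)
    PermutationModulo-∷⁺ r (_ , rs , p) = _ , r ∷ rs , ↭.prep _ p

    PermutationModulo-++⁺ : ∀ {xs ys us vs} → PermutationModulo R xs ys → PermutationModulo R us vs →
                            PermutationModulo R (xs ++ us) (ys ++ vs)
    PermutationModulo-++⁺ (_ , rs , p) (_ , rs′ , p′) = _ , Pointwise.++⁺ rs rs′ , Perm.++⁺ p p′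

    module _ (R-sym : ∀ {x y} → R x y → R y x)
             (R-trans : ∀ {x y z} → R x y → R y z → R x z) where

      PermutationModulo-sym : ∀ {xs ys} → PermutationModulo R xs ys → PermutationModulo R ys xs
      PermutationModulo-sym (_ , rs , p) = ↭-Pointwise-commute (↭-sym p) (Pointwise.symmetric R-sym rs)

      PermutationModulo-trans : ∀ {xs ys zs} → PermutationModulo R xs ys → PermutationModulo R ys zs →
                                PermutationModulo R xs zs
      PermutationModulo-trans (_ , rs , p) (_ , rs′ , p′) with ↭-Pointwise-commute p rs′
      ... | _ , rs″ , q = _ , Pointwise.transitive R-trans rs rs″ , ↭.trans q p′

PermutationModulo-map⁺ : {A B : Set} {R : A → A → Set} {S : B → B → Set} (f g : A → B) →
                         (∀ {x y} → R x y → S (f x) (g y)) →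
                         ∀ {xs ys} → PermutationModulo R xs ys → PermutationModulo S (map f xs) (map g ys)
PermutationModulo-map⁺ f g f∼g (_ , rs , p) = _ , Pointwise.map⁺ f g (Pointwise.map f∼g rs) , Perm.map⁺ g p

module TreeIso {D : Set} (_≟_ : DecidableEquality D) where
  open Trees {D}
  open Iso _≟_

  data _≅_ : PTree D → PTree D → Set where
    node : ∀ {d ts vs us} → Pointwise _≅_ ts vs → vs ↭ us → node d ts ≅ node d us

  _≅ᶠ_ : List (PTree D) → List (PTree D) → Set
  _≅ᶠ_ = PermutationModulo _≅_

  mutual
    ≅-refl : ∀ {t} → t ≅ t
    ≅-refl {node d ts} = node ≅ᵖ-refl ↭.refl

    ≅ᵖ-refl : ∀ {ts} → Pointwise _≅_ ts ts
    ≅ᵖ-refl {[]} = []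
    ≅ᵖ-refl {t ∷ ts} = ≅-refl ∷ ≅ᵖ-refl

  mutual
    ≅-sym : ∀ {t u} → t ≅ u → u ≅ t
    ≅-sym (node rs p) with ↭-Pointwise-commute (↭-sym p) (≅ᵖ-sym rs)
    ... | _ , rs′ , p′ = node rs′ p′

    ≅ᵖ-sym : ∀ {ts us} → Pointwise _≅_ ts us → Pointwise _≅_ us ts
    ≅ᵖ-sym [] = []
    ≅ᵖ-sym (r ∷ rs) = ≅-sym r ∷ ≅ᵖ-sym rs

  mutual
    ≅-trans : ∀ {t u v} → t ≅ u → u ≅ v → t ≅ v
    ≅-trans (node rs p) (node rs′ p′) with ↭-Pointwise-commute p rs′
    ... | _ , rs″ , q = node (≅ᵖ-trans rs rs″) (↭.trans q p′)

    ≅ᵖ-trans : ∀ {ts us vs} → Pointwise _≅_ ts us → Pointwise _≅_ us vs → Pointwise _≅_ ts vs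
    ≅ᵖ-trans [] [] = []
    ≅ᵖ-trans (r ∷ rs) (r′ ∷ rs′) = ≅-trans r r′ ∷ ≅ᵖ-trans rs rs′

  ≅ᶠ-refl : ∀ {ts} → ts ≅ᶠ ts
  ≅ᶠ-refl = ↭⇒PermutationModulo ≅-refl ↭.refl

  ≅ᶠ-sym : ∀ {ts us} → ts ≅ᶠ us → us ≅ᶠ ts
  ≅ᶠ-sym = PermutationModulo-sym ≅-sym ≅-trans

  ≅ᶠ-trans : ∀ {ts us vs} → ts ≅ᶠ us → us ≅ᶠ vs → ts ≅ᶠ vs
  ≅ᶠ-trans = PermutationModulo-trans ≅-sym ≅-trans

  removeIso-sound : ∀ t us vs → removeIso t us ≡ just vs →
                    ∃ λ u → isoT t u ≡ true × (u ∷ vs) ↭ us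
  removeIso-sound t (u ∷ us) vs h with isoT t u in t≅u
  removeIso-sound t (u ∷ us) vs ≡.refl | true = u , t≅u , ↭.refl
  ... | false with removeIso t us in eq
  removeIso-sound t (u ∷ us) _ ≡.refl | false | just ws with removeIso-sound t us ws eq
  ... | u′ , t≅u′ , p = u′ , t≅u′ , ↭.trans (↭.swap u′ u ↭.refl) (↭.prep u p)

  mutual
    isoT-sound : ∀ t u → isoT t u ≡ true → t ≅ u
    isoT-sound (node d ts) (node e us) h with d ≟ e
    ... | yes ≡.refl with isoL-sound ts us h
    ...   | _ , rs , p = node rs p

    isoL-sound : ∀ ts us → isoL ts us ≡ true → ts ≅ᶠ us
    isoL-sound [] [] h = ≅ᶠ-refl
    isoL-sound (t ∷ ts) us h with removeIso t us in eq
    ... | just vs with removeIso-sound t us vs eq | isoL-sound ts vs h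
    ...   | u , t≅u , p | _ , rs , q = _ , isoT-sound t u t≅u ∷ rs , ↭.trans (↭.prep u q) p

  removeIso-complete : ∀ t us {u} → u ∈ us → isoT t u ≡ true →
                       ∃₂ λ pre post → ∃ λ u′ → us ≡ pre ++ u′ ∷ post × isoT t u′ ≡ true ×
                                              removeIso t us ≡ just (pre ++ post)
  removeIso-complete t (w ∷ ws) u∈us h with isoT t w in t≅w
  ... | true = [] , ws , w , ≡.refl , t≅w , ≡.refl
  removeIso-complete t (w ∷ ws) (here ≡.refl) h | false with () ← ≡.trans (≡.sym t≅w) h
  removeIso-complete t (w ∷ ws) (there u∈ws) h | false
    with pre , post , u′ , ≡.refl , t≅u′ , eq ← removeIso-complete t ws u∈ws h rewrite eq
    = w ∷ pre , post , u′ , ≡.refl , t≅u′ , ≡.refl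

  does-≟-refl : ∀ d → does (d ≟ d) ≡ true
  does-≟-refl d with d ≟ d
  ... | yes _ = ≡.refl
  ... | no d≢d = ⊥-elim (d≢d ≡.refl)

  Pointwise-updateAt : ∀ xs {ys ts v v′} → Pointwise _≅_ ys (xs ++ v ∷ ts) →
                       (∀ {x} → x ≅ v → x ≅ v′) → Pointwise _≅_ ys (xs ++ v′ ∷ ts)
  Pointwise-updateAt [] (r ∷ rs) f = f r ∷ rs
  Pointwise-updateAt (x ∷ xs) (r ∷ rs) f = r ∷ Pointwise-updateAt xs rs f

  mutual
    isoT-complete : ∀ t u → t ≅ u → isoT t u ≡ true
    isoT-complete (node d ts) (node .d us) (node rs p) rewrite does-≟-refl d =
      isoL-complete ts us (_ , rs , p)

    -- If removeIso picks u′ for t while the isomorphism matched u′ with some s ∈ ts,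
    -- then s is re-matched with the partner v of t, because s ≅ u′ ≅ t ≅ v.
    isoL-complete : ∀ ts us → ts ≅ᶠ us → isoL ts us ≡ true
    isoL-complete [] us (_ , [] , p) rewrite Perm.↭-empty-inv (↭-sym p) = ≡.refl
    isoL-complete (t ∷ ts) us (v ∷ vs , t≅v ∷ rs , p)
      with pre , post , u′ , ≡.refl , t≅u′ , eq
             ← removeIso-complete t us (Perm.∈-resp-↭ p (here ≡.refl)) (isoT-complete t v t≅v)
      rewrite eq = isoL-complete ts (pre ++ post) (rematch (Perm.∈-resp-↭ (↭-sym p) (∈.∈-insert pre)))
      where
      rematch : u′ ∈ v ∷ vs → ts ≅ᶠ (pre ++ post)
      rematch (here ≡.refl) = vs , rs , Perm.drop-mid [] pre p
      rematch (there u′∈vs) with xs , ys , ≡.refl ← ∈.∈-∃++ u′∈vs =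
        xs ++ v ∷ ys ,
        Pointwise-updateAt xs rs (λ s≅u′ → ≅-trans s≅u′ (≅-trans (≅-sym (isoT-sound t u′ t≅u′)) t≅v)) ,
        ↭.trans (Perm.shift v xs ys) (Perm.drop-mid (v ∷ xs) pre p)

  isoT-refl : ∀ t → isoT t t ≡ true
  isoT-refl t = isoT-complete t t ≅-refl

  isoT-sym : ∀ t u → isoT t u ≡ true → isoT u t ≡ true
  isoT-sym t u h = isoT-complete u t (≅-sym (isoT-sound t u h))

  isoT-trans : ∀ t u v → isoT t u ≡ true → isoT u v ≡ true → isoT t v ≡ true
  isoT-trans t u v h h′ = isoT-complete t v (≅-trans (isoT-sound t u h) (isoT-sound u v h′))

  isoT-respˡ : ∀ {v v′} → v ≅ v′ → ∀ u → isoT v u ≡ isoT v′ u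
  isoT-respˡ {v} {v′} v≅v′ u with isoT v u in e | isoT v′ u in e′
  ... | true  | true  = ≡.refl
  ... | false | false = ≡.refl
  ... | true  | false = ≡.trans (≡.sym (isoT-complete v′ u (≅-trans (≅-sym v≅v′) (isoT-sound v u e)))) e′
  ... | false | true  = ≡.trans (≡.sym e) (isoT-complete v u (≅-trans v≅v′ (isoT-sound v′ u e′)))

  private
    Forests = List (List (PTree D))

  ≅ᶠ*-refl : ∀ {tss : Forests} → PermutationModulo _≅ᶠ_ tss tss
  ≅ᶠ*-refl = ↭⇒PermutationModulo ≅ᶠ-refl ↭.refl

  ≅ᶠ*-trans : ∀ {tss uss vss : Forests} → PermutationModulo _≅ᶠ_ tss uss →
              PermutationModulo _≅ᶠ_ uss vss → PermutationModulo _≅ᶠ_ tss vss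
  ≅ᶠ*-trans = PermutationModulo-trans ≅ᶠ-sym ≅ᶠ-trans

  -- Grafting s onto x, onto y or onto the rest gives three blocks, which the swap
  -- reorders from (x , y , rest) to (y , x , rest).
  graftL-swap : ∀ s x y {vs us} → vs ↭ us → PermutationModulo _≅ᶠ_ (graftL s vs) (graftL s us) →
                PermutationModulo _≅ᶠ_ (graftL s (x ∷ y ∷ vs)) (graftL s (y ∷ x ∷ us))
  graftL-swap s x y {vs} {us} p rest =
    ≡.subst₂ (PermutationModulo _≅ᶠ_) lhs rhs
             (≅ᶠ*-trans blocks (↭⇒PermutationModulo ≅ᶠ-refl (Perm.shifts intoX intoY)))
    where
    swapped : ∀ {a b c d} → a ≅ b → c ≅ d → ∀ {ws ws′} → ws ≅ᶠ ws′ → (a ∷ c ∷ ws) ≅ᶠ (d ∷ b ∷ ws′)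
    swapped a≅b c≅d (_ , rs , q) = _ , a≅b ∷ c≅d ∷ rs , ↭.swap _ _ q
    intoX = map (λ a → y ∷ a ∷ us) (graftT s x)
    intoY = map (λ b → b ∷ x ∷ us) (graftT s y)
    intoRest = map (λ c → y ∷ x ∷ c) (graftL s us)
    blocks : PermutationModulo _≅ᶠ_
               (map (_∷ y ∷ vs) (graftT s x) ++ (map (λ b → x ∷ b ∷ vs) (graftT s y) ++
                                                 map (λ c → x ∷ y ∷ c) (graftL s vs)))
               (intoX ++ (intoY ++ intoRest))
    blocks =
      PermutationModulo-++⁺
        (PermutationModulo-map⁺ (_∷ y ∷ vs) (λ a → y ∷ a ∷ us)
          (λ a≅b → swapped a≅b ≅-refl (↭⇒PermutationModulo ≅-refl p))
          (↭⇒PermutationModulo ≅-refl {graftT s x} ↭.refl))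
        (PermutationModulo-++⁺
          (PermutationModulo-map⁺ (λ b → x ∷ b ∷ vs) (λ b → b ∷ x ∷ us)
            (λ a≅b → swapped ≅-refl a≅b (↭⇒PermutationModulo ≅-refl p))
            (↭⇒PermutationModulo ≅-refl {graftT s y} ↭.refl))
          (PermutationModulo-map⁺ (λ c → x ∷ y ∷ c) (λ c → y ∷ x ∷ c) (swapped ≅-refl ≅-refl) rest))
    lhs : _ ≡ graftL s (x ∷ y ∷ vs)
    lhs = cong (map (_∷ y ∷ vs) (graftT s x) ++_)
      (≡.trans (cong₂ _++_ (List.map-∘ (graftT s y)) (List.map-∘ (graftL s vs)))
               (≡.sym (List.map-++ (x ∷_) (map (_∷ vs) (graftT s y)) (map (y ∷_) (graftL s vs)))))
    rhs : intoY ++ (intoX ++ intoRest) ≡ graftL s (y ∷ x ∷ us)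
    rhs = cong (intoY ++_)
      (≡.trans (cong₂ _++_ (List.map-∘ (graftT s x)) (List.map-∘ (graftL s us)))
               (≡.sym (List.map-++ (y ∷_) (map (_∷ us) (graftT s x)) (map (x ∷_) (graftL s us)))))

  graftL-resp-↭ : ∀ {s vs us} → vs ↭ us → PermutationModulo _≅ᶠ_ (graftL s vs) (graftL s us)
  graftL-resp-↭ ↭.refl = ≅ᶠ*-refl
  graftL-resp-↭ {s} {x ∷ vs} {x ∷ us} (↭.prep x p) =
    PermutationModulo-++⁺
      (PermutationModulo-map⁺ (_∷ vs) (_∷ us) (λ a≅b → PermutationModulo-∷⁺ a≅b (↭⇒PermutationModulo ≅-refl p))
                              (↭⇒PermutationModulo ≅-refl ↭.refl))
      (PermutationModulo-map⁺ (x ∷_) (x ∷_) (PermutationModulo-∷⁺ ≅-refl) (graftL-resp-↭ p))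
  graftL-resp-↭ {s} (↭.swap x y p) = graftL-swap s x y p (graftL-resp-↭ p)
  graftL-resp-↭ (↭.trans p q) = ≅ᶠ*-trans (graftL-resp-↭ p) (graftL-resp-↭ q)

  mutual
    graftT-resp-≅ : ∀ {s s′ t t′} → s ≅ s′ → t ≅ t′ → PermutationModulo _≅_ (graftT s t) (graftT s′ t′)
    graftT-resp-≅ {s′ = s′} s≅s′ (node {d} rs p) =
      PermutationModulo-∷⁺ (node (s≅s′ ∷ rs) (↭.prep s′ p))
        (PermutationModulo-map⁺ (node d) (node d) (λ (_ , rs′ , p′) → node rs′ p′)
          (≅ᶠ*-trans (graftL-resp-Pointwise s≅s′ rs) (graftL-resp-↭ p)))

    graftL-resp-Pointwise : ∀ {s s′ ts vs} → s ≅ s′ → Pointwise _≅_ ts vs →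
                            PermutationModulo _≅ᶠ_ (graftL s ts) (graftL s′ vs)
    graftL-resp-Pointwise s≅s′ [] = Pointwise⇒PermutationModulo []
    graftL-resp-Pointwise s≅s′ (r ∷ rs) =
      PermutationModulo-++⁺
        (PermutationModulo-map⁺ _ _ (λ a≅b → PermutationModulo-∷⁺ a≅b (Pointwise⇒PermutationModulo rs))
                                (graftT-resp-≅ s≅s′ r))
        (PermutationModulo-map⁺ _ _ (PermutationModulo-∷⁺ r) (graftL-resp-Pointwise s≅s′ rs))

  module _ (w : D → ℕ) where
    open Degree w

    degL-resp-↭ : ∀ {ts us} → ts ↭ us → degL ts ≡ degL us
    degL-resp-↭ ↭.refl = ≡.refl
    degL-resp-↭ (↭.prep t p) = cong (deg t ℕ.+_) (degL-resp-↭ p)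
    degL-resp-↭ {t ∷ u ∷ ts} (↭.swap t u p) =
      ≡.trans (ℕ+.x∙yz≈y∙xz (deg t) (deg u) (degL ts)) (cong (λ n → deg u ℕ.+ (deg t ℕ.+ n)) (degL-resp-↭ p))
    degL-resp-↭ (↭.trans p q) = ≡.trans (degL-resp-↭ p) (degL-resp-↭ q)

    mutual
      deg-resp-≅ : ∀ {t u} → t ≅ u → deg t ≡ deg u
      deg-resp-≅ (node {d} rs p) = cong (w d ℕ.+_) (≡.trans (degL-resp-Pointwise rs) (degL-resp-↭ p))

      degL-resp-Pointwise : ∀ {ts us} → Pointwise _≅_ ts us → degL ts ≡ degL us
      degL-resp-Pointwise [] = ≡.refl
      degL-resp-Pointwise (r ∷ rs) = cong₂ ℕ._+_ (deg-resp-≅ r) (degL-resp-Pointwise rs)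

module _ {D : Set} (w : D → ℕ) where
  open Trees {D}
  open Degree w

  mutual
    graftT-deg : ∀ s t → All (λ v → deg v ≡ deg s ℕ.+ deg t) (graftT s t)
    graftT-deg s (node d ts) =
      ℕ+.x∙yz≈y∙xz (w d) (deg s) (degL ts) ∷
      All-map⁺ (node d) (λ f∈grafts → ≡.trans (cong (w d ℕ.+_) (All.lookup (graftL-deg s ts) f∈grafts))
                                     (ℕ+.x∙yz≈y∙xz (w d) (deg s) (degL ts)))

    graftL-deg : ∀ s ts → All (λ f → degL f ≡ deg s ℕ.+ degL ts) (graftL s ts)
    graftL-deg s [] = []
    graftL-deg s (t ∷ ts) = All.++⁺
      (All-map⁺ (_∷ ts) (λ v∈grafts → ≡.trans (cong (ℕ._+ degL ts) (All.lookup (graftT-deg s t) v∈grafts))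
                                      (ℕ.+-assoc (deg s) (deg t) (degL ts))))
      (All-map⁺ (t ∷_) (λ f∈grafts → ≡.trans (cong (deg t ℕ.+_) (All.lookup (graftL-deg s ts) f∈grafts))
                                      (ℕ+.x∙yz≈y∙xz (deg t) (deg s) (degL ts))))

module ListSum {c ℓ} (R : CommutativeRing c ℓ) where
  open CommutativeRing R renaming (Carrier to K)
  open import Relation.Binary.Reasoning.Setoid setoid
  open import Algebra.Properties.CommutativeSemigroup +-commutativeSemigroup using (interchange)

  private variable
    a : Level
    A B : Set a

  ∑ : List A → (A → K) → K
  ∑ [] f = 0#
  ∑ (x ∷ xs) f = f x + ∑ xs f

  syntax ∑ xs (λ x → e) = ∑[ x ← xs ] e

  ∑-cong : ∀ (xs : List A) {f g} → (∀ x → f x ≈ g x) → ∑ xs f ≈ ∑ xs g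
  ∑-cong [] f≈g = refl
  ∑-cong (x ∷ xs) f≈g = +-cong (f≈g x) (∑-cong xs f≈g)

  ∑-zero : ∀ (xs : List A) {f} → (∀ x → x ∈ xs → f x ≈ 0#) → ∑ xs f ≈ 0#
  ∑-zero [] f≈0 = refl
  ∑-zero (x ∷ xs) f≈0 = trans (+-cong (f≈0 x (here ≡.refl)) (∑-zero xs (λ y y∈xs → f≈0 y (there y∈xs))))
                              (+-identityˡ 0#)

  ∑-++ : ∀ (xs ys : List A) f → ∑ (xs ++ ys) f ≈ ∑ xs f + ∑ ys f
  ∑-++ [] ys f = sym (+-identityˡ _)
  ∑-++ (x ∷ xs) ys f = trans (+-congˡ (∑-++ xs ys f)) (sym (+-assoc _ _ _))

  ∑-+ : ∀ (xs : List A) f g → ∑[ x ← xs ] (f x + g x) ≈ ∑ xs f + ∑ xs g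
  ∑-+ [] f g = sym (+-identityˡ 0#)
  ∑-+ (x ∷ xs) f g = trans (+-congˡ (∑-+ xs f g)) (interchange _ _ _ _)

  *-distribˡ-∑ : ∀ k (xs : List A) f → k * ∑ xs f ≈ ∑[ x ← xs ] (k * f x)
  *-distribˡ-∑ k [] f = zeroʳ k
  *-distribˡ-∑ k (x ∷ xs) f = trans (distribˡ _ _ _) (+-congˡ (*-distribˡ-∑ k xs f))

  ∑-↭ : ∀ {xs ys : List A} f → xs ↭ ys → ∑ xs f ≈ ∑ ys f
  ∑-↭ f ↭.refl = refl
  ∑-↭ f (↭.prep x p) = +-congˡ (∑-↭ f p)
  ∑-↭ f (↭.swap x y p) = trans (sym (+-assoc _ _ _)) (trans (+-cong (+-comm _ _) (∑-↭ f p)) (+-assoc _ _ _))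
  ∑-↭ f (↭.trans p q) = trans (∑-↭ f p) (∑-↭ f q)

  ∑-map : ∀ (g : A → B) (xs : List A) f → ∑ (map g xs) f ≡ ∑ xs (f ∘ g)
  ∑-map g [] f = ≡.refl
  ∑-map g (x ∷ xs) f = cong (f (g x) +_) (∑-map g xs f)

  ∑-concatMap : ∀ (g : A → List B) (xs : List A) f → ∑ (concatMap g xs) f ≈ ∑[ x ← xs ] ∑ (g x) f
  ∑-concatMap g [] f = refl
  ∑-concatMap g (x ∷ xs) f = trans (∑-++ (g x) (concatMap g xs) f) (+-congˡ (∑-concatMap g xs f))

  ∑-comm : ∀ (xs : List A) (ys : List B) (f : A → B → K) →
           ∑[ x ← xs ] ∑[ y ← ys ] f x y ≈ ∑[ y ← ys ] ∑[ x ← xs ] f x y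
  ∑-comm [] ys f = sym (∑-zero ys (λ _ _ → refl))
  ∑-comm (x ∷ xs) ys f = trans (+-congˡ (∑-comm xs ys f)) (sym (∑-+ ys (f x) _))

  ∑< : ℕ → (ℕ → K) → K
  ∑< zero f = 0#
  ∑< (suc n) f = f 0 + ∑< n (f ∘ suc)

  syntax ∑< n (λ i → e) = ∑[ i < n ] e

  ∑-upTo : ∀ n f → ∑ (upTo n) f ≡ ∑< n f
  ∑-upTo n f = applyUpTo-sum n (λ i → i)
    where
    applyUpTo-sum : ∀ n (g : ℕ → ℕ) → ∑ (applyUpTo g n) f ≡ ∑< n (f ∘ g)
    applyUpTo-sum zero g = ≡.refl
    applyUpTo-sum (suc n) g = cong (f (g 0) +_) (applyUpTo-sum n (g ∘ suc))

  ∑<-cong : ∀ n {f g} → (∀ i → i ℕ.< n → f i ≈ g i) → ∑< n f ≈ ∑< n g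
  ∑<-cong zero f≈g = refl
  ∑<-cong (suc n) f≈g = +-cong (f≈g 0 (ℕ.s≤s ℕ.z≤n)) (∑<-cong n (λ i i<n → f≈g (suc i) (ℕ.s≤s i<n)))

  ∑<-zero : ∀ n {f} → (∀ i → i ℕ.< n → f i ≈ 0#) → ∑< n f ≈ 0#
  ∑<-zero zero f≈0 = refl
  ∑<-zero (suc n) f≈0 =
    trans (+-cong (f≈0 0 (ℕ.s≤s ℕ.z≤n)) (∑<-zero n (λ i i<n → f≈0 (suc i) (ℕ.s≤s i<n)))) (+-identityˡ 0#)

  ∑<-+ : ∀ n f g → ∑[ i < n ] (f i + g i) ≈ ∑< n f + ∑< n g
  ∑<-+ zero f g = sym (+-identityˡ 0#)
  ∑<-+ (suc n) f g = trans (+-congˡ (∑<-+ n (f ∘ suc) (g ∘ suc))) (interchange _ _ _ _)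

  ∑<-last : ∀ n f → ∑< (suc n) f ≈ ∑< n f + f n
  ∑<-last zero f = +-comm _ _
  ∑<-last (suc n) f = trans (+-congˡ (∑<-last n (f ∘ suc))) (sym (+-assoc _ _ _))

  ∑<-triangle : ∀ d (f : ℕ → ℕ → K) →
    ∑[ k < suc d ] ∑[ i < d ∸ k ] f k i ≈ ∑[ i < d ] ∑[ k < suc (d ∸ suc i) ] f k i
  ∑<-triangle zero f = +-identityˡ 0#
  ∑<-triangle (suc d) f = begin
      ∑[ i < suc d ] f 0 i + ∑[ k < suc d ] ∑[ i < d ∸ k ] f (suc k) i
    ≈⟨ +-congˡ (∑<-triangle d (f ∘ suc)) ⟩
      ∑[ i < suc d ] f 0 i + ∑[ i < d ] ∑[ k < suc (d ∸ suc i) ] f (suc k) i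
    ≈⟨ +-congˡ (sym extendRange) ⟩
      ∑[ i < suc d ] f 0 i + ∑[ i < suc d ] ∑[ k < d ∸ i ] f (suc k) i
    ≈⟨ sym (∑<-+ (suc d) (f 0) (λ i → ∑[ k < d ∸ i ] f (suc k) i)) ⟩
      ∑[ i < suc d ] (f 0 i + ∑[ k < d ∸ i ] f (suc k) i)
    ∎
    where
    extendRange : ∑[ i < suc d ] ∑[ k < d ∸ i ] f (suc k) i ≈ ∑[ i < d ] ∑[ k < suc (d ∸ suc i) ] f (suc k) i
    extendRange = begin
        ∑[ i < suc d ] ∑[ k < d ∸ i ] f (suc k) i
      ≈⟨ ∑<-last d _ ⟩
        ∑[ i < d ] ∑[ k < d ∸ i ] f (suc k) i + ∑[ k < d ∸ d ] f (suc k) d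
      ≡⟨ cong (λ m → ∑[ i < d ] ∑[ k < d ∸ i ] f (suc k) i + ∑< m (λ k → f (suc k) d)) (ℕ.n∸n≡0 d) ⟩
        ∑[ i < d ] ∑[ k < d ∸ i ] f (suc k) i + 0#
      ≈⟨ +-identityʳ _ ⟩
        ∑[ i < d ] ∑[ k < d ∸ i ] f (suc k) i
      ≈⟨ ∑<-cong d (λ i i<d → reflexive (cong (λ m → ∑< m (λ k → f (suc k) i)) (ℕ.+-∸-assoc 1 i<d))) ⟩
        ∑[ i < d ] ∑[ k < suc (d ∸ suc i) ] f (suc k) i
      ∎

  ∑-upTo-triangle : ∀ d (f : ℕ → ℕ → K) →
    ∑[ k ← upTo (suc d) ] ∑[ i ← upTo (d ∸ k) ] f k i ≈ ∑[ i ← upTo d ] ∑[ k ← upTo (suc (d ∸ suc i)) ] f k i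
  ∑-upTo-triangle d f = begin
      ∑[ k ← upTo (suc d) ] ∑[ i ← upTo (d ∸ k) ] f k i
    ≡⟨ ∑-upTo (suc d) _ ⟩
      ∑[ k < suc d ] ∑[ i ← upTo (d ∸ k) ] f k i
    ≈⟨ ∑<-cong (suc d) (λ k _ → reflexive (∑-upTo (d ∸ k) (f k))) ⟩
      ∑[ k < suc d ] ∑[ i < d ∸ k ] f k i
    ≈⟨ ∑<-triangle d f ⟩
      ∑[ i < d ] ∑[ k < suc (d ∸ suc i) ] f k i
    ≈⟨ ∑<-cong d (λ i _ → reflexive (∑-upTo (suc (d ∸ suc i)) (λ k → f k i))) ⟨
      ∑[ i < d ] ∑[ k ← upTo (suc (d ∸ suc i)) ] f k i
    ≡⟨ ∑-upTo d _ ⟨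
      ∑[ i ← upTo d ] ∑[ k ← upTo (suc (d ∸ suc i)) ] f k i
    ∎

module Coefficients {c ℓ} (R : CommutativeRing c ℓ) {D : Set} (_≟D_ : DecidableEquality D) where
  open CommutativeRing R renaming (Carrier to K)
  open import Relation.Binary.Reasoning.Setoid setoid
  open ListSum R
  open Trees {D}
  open Iso _≟D_ using (isoT)
  open TreeIso _≟D_
  open Sums R _≟D_ using (FSum; coeff; _⊙_; _⇒_)

  private variable
    a : Level
    A : Set a

  indicator : Bool → K
  indicator true = 1#
  indicator false = 0#

  pairing : FSum → (PTree D → K) → K
  pairing x g = ∑[ p ← x ] (proj₁ p * g (proj₂ p))

  isoTo : PTree D → PTree D → K
  isoTo u t = indicator (isoT t u)

  coeff-as-pairing : ∀ x u → coeff x u ≈ pairing x (isoTo u)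
  coeff-as-pairing [] u = refl
  coeff-as-pairing ((k , t) ∷ x) u with isoT t u
  ... | true = +-cong (sym (*-identityʳ k)) (coeff-as-pairing x u)
  ... | false = trans (sym (+-identityˡ _)) (+-cong (sym (zeroʳ k)) (coeff-as-pairing x u))

  pairing-cong : ∀ x {g g′} → (∀ t → g t ≈ g′ t) → pairing x g ≈ pairing x g′
  pairing-cong x g≈g′ = ∑-cong x (λ p → *-congˡ (g≈g′ (proj₂ p)))

  pairing-concatMap : ∀ (f : A → FSum) (xs : List A) g →
                      pairing (concatMap f xs) g ≈ ∑[ y ← xs ] pairing (f y) g
  pairing-concatMap f xs g = ∑-concatMap f xs _

  pairing-⊙ : ∀ k x g → pairing (k ⊙ x) g ≈ k * pairing x g
  pairing-⊙ k x g = begin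
      pairing (k ⊙ x) g
    ≡⟨ ∑-map _ x _ ⟩
      ∑[ p ← x ] ((k * proj₁ p) * g (proj₂ p))
    ≈⟨ ∑-cong x (λ p → *-assoc _ _ _) ⟩
      ∑[ p ← x ] (k * (proj₁ p * g (proj₂ p)))
    ≈⟨ *-distribˡ-∑ k x _ ⟨
      k * pairing x g
    ∎

  pairing-*ˡ : ∀ k x g → pairing x (λ t → k * g t) ≈ k * pairing x g
  pairing-*ˡ k x g = begin
      ∑[ p ← x ] (proj₁ p * (k * g (proj₂ p)))
    ≈⟨ ∑-cong x (λ p → x∙yz≈y∙xz _ _ _) ⟩
      ∑[ p ← x ] (k * (proj₁ p * g (proj₂ p)))
    ≈⟨ *-distribˡ-∑ k x _ ⟨
      k * pairing x g
    ∎
    where open import Algebra.Properties.CommutativeSemigroup *-commutativeSemigroup using (x∙yz≈y∙xz)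

  pairing-∑ : ∀ (xs : List A) x (g : A → PTree D → K) →
              pairing x (λ t → ∑[ y ← xs ] g y t) ≈ ∑[ y ← xs ] pairing x (g y)
  pairing-∑ xs x g = begin
      ∑[ p ← x ] (proj₁ p * ∑[ y ← xs ] g y (proj₂ p))
    ≈⟨ ∑-cong x (λ p → *-distribˡ-∑ (proj₁ p) xs _) ⟩
      ∑[ p ← x ] ∑[ y ← xs ] (proj₁ p * g y (proj₂ p))
    ≈⟨ ∑-comm x xs _ ⟩
      ∑[ y ← xs ] pairing x (g y)
    ∎

  countIso : List (PTree D) → PTree D → K
  countIso ts u = ∑ ts (isoTo u)

  coeff-⇒-as-pairing : ∀ x y u → coeff (x ⇒ y) u ≈ pairing x (λ s → pairing y (λ t → countIso (graftT s t) u))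
  coeff-⇒-as-pairing x y u = begin
      coeff (x ⇒ y) u
    ≈⟨ coeff-as-pairing (x ⇒ y) u ⟩
      pairing (x ⇒ y) (isoTo u)
    ≈⟨ pairing-concatMap _ x _ ⟩
      ∑[ p ← x ] pairing (concatMap (grafts p) y) (isoTo u)
    ≈⟨ ∑-cong x (λ p → pairing-concatMap _ y _) ⟩
      ∑[ p ← x ] ∑[ q ← y ] pairing (map (proj₁ p * proj₁ q ,_) (graftT (proj₂ p) (proj₂ q))) (isoTo u)
    ≈⟨ ∑-cong x (λ p → ∑-cong y (λ q → graftTerm p q)) ⟩
      ∑[ p ← x ] ∑[ q ← y ] (proj₁ p * (proj₁ q * countIso (graftT (proj₂ p) (proj₂ q)) u))
    ≈⟨ ∑-cong x (λ p → *-distribˡ-∑ (proj₁ p) y _) ⟨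
      pairing x (λ s → pairing y (λ t → countIso (graftT s t) u))
    ∎
    where
    grafts : K × PTree D → K × PTree D → FSum
    grafts p q = map (proj₁ p * proj₁ q ,_) (graftT (proj₂ p) (proj₂ q))
    graftTerm : ∀ p q → pairing (grafts p q) (isoTo u) ≈
                        proj₁ p * (proj₁ q * countIso (graftT (proj₂ p) (proj₂ q)) u)
    graftTerm p q = begin
        pairing (grafts p q) (isoTo u)
      ≡⟨ ∑-map _ (graftT (proj₂ p) (proj₂ q)) _ ⟩
        ∑[ v ← graftT (proj₂ p) (proj₂ q) ] ((proj₁ p * proj₁ q) * isoTo u v)
      ≈⟨ *-distribˡ-∑ _ (graftT (proj₂ p) (proj₂ q)) _ ⟨
        (proj₁ p * proj₁ q) * countIso (graftT (proj₂ p) (proj₂ q)) u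
      ≈⟨ *-assoc _ _ _ ⟩
        proj₁ p * (proj₁ q * countIso (graftT (proj₂ p) (proj₂ q)) u)
      ∎

  countIso-resp : ∀ {ts us} → PermutationModulo _≅_ ts us → ∀ u → countIso ts u ≈ countIso us u
  countIso-resp (_ , rs , p) u = trans (reflexive (pointwise rs)) (∑-↭ _ p)
    where
    pointwise : ∀ {ts vs} → Pointwise _≅_ ts vs → countIso ts u ≡ countIso vs u
    pointwise [] = ≡.refl
    pointwise (r ∷ rs) = cong₂ _+_ (cong indicator (isoT-respˡ r u)) (pointwise rs)

  IsoInvariant : (PTree D → K) → Set ℓ
  IsoInvariant g = ∀ t t′ → isoT t t′ ≡ true → g t ≈ g t′

  anyIso : PTree D → List (PTree D) → Bool
  anyIso t [] = false
  anyIso t (r ∷ rs) = if isoT t r then true else anyIso t rs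

  -- pairings with isomorphism-invariant functions are regrouped along these representatives
  representatives : List (PTree D) → List (PTree D)
  representatives [] = []
  representatives (t ∷ ts) = if anyIso t (representatives ts) then representatives ts
                             else t ∷ representatives ts

  IsoCovers : List (PTree D) → PTree D → Set
  IsoCovers rs t = Any (λ r → isoT t r ≡ true) rs

  data IsoDistinct : List (PTree D) → Set where
    []  : IsoDistinct []
    _∷_ : ∀ {r rs} → All (λ r′ → isoT r r′ ≡ false) rs → IsoDistinct rs → IsoDistinct (r ∷ rs)

  anyIso-true : ∀ t rs → anyIso t rs ≡ true → IsoCovers rs t
  anyIso-true t (r ∷ rs) h with isoT t r in t≅r
  ... | true = here t≅r
  ... | false = there (anyIso-true t rs h)

  anyIso-false : ∀ t rs → anyIso t rs ≡ false → All (λ r → isoT t r ≡ false) rs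
  anyIso-false t [] h = []
  anyIso-false t (r ∷ rs) h with isoT t r in t≇r
  ... | false = t≇r ∷ anyIso-false t rs h

  representatives-distinct : ∀ ts → IsoDistinct (representatives ts)
  representatives-distinct [] = []
  representatives-distinct (t ∷ ts) with anyIso t (representatives ts) in eq
  ... | true = representatives-distinct ts
  ... | false = anyIso-false t (representatives ts) eq ∷ representatives-distinct ts

  representatives-cover : ∀ ts {t} → t ∈ ts → IsoCovers (representatives ts) t
  representatives-cover (t ∷ ts) t∈ts with anyIso t (representatives ts) in eq
  representatives-cover (t ∷ ts) (here ≡.refl) | true = anyIso-true t (representatives ts) eq
  representatives-cover (t ∷ ts) (there t∈ts)  | true = representatives-cover ts t∈ts
  representatives-cover (t ∷ ts) (here ≡.refl) | false = here (isoT-refl t)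
  representatives-cover (t ∷ ts) (there t∈ts)  | false = there (representatives-cover ts t∈ts)

  ∑-representatives : ∀ rs t g → IsoInvariant g → IsoDistinct rs → IsoCovers rs t →
                      ∑[ r ← rs ] (isoTo r t * g r) ≈ g t
  ∑-representatives (r ∷ rs) t g inv (r≇rs ∷ distinct) covers with isoT t r in t≅r
  ... | true = begin
      1# * g r + ∑[ r′ ← rs ] (isoTo r′ t * g r′)
    ≈⟨ +-cong (*-identityˡ _) (∑-zero rs others) ⟩
      g r + 0#
    ≈⟨ +-identityʳ _ ⟩
      g r
    ≈⟨ inv t r t≅r ⟨
      g t
    ∎
    where
    others : ∀ r′ → r′ ∈ rs → isoTo r′ t * g r′ ≈ 0#
    others r′ r′∈rs with isoT t r′ in t≅r′
    ... | false = zeroˡ _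
    ... | true with () ← ≡.trans (≡.sym (isoT-trans r t r′ (isoT-sym t r t≅r) t≅r′)) (All.lookup r≇rs r′∈rs)
  ... | false with covers
  ...   | here t≅r′ with () ← ≡.trans (≡.sym t≅r′) t≅r
  ...   | there covers′ = trans (+-cong (zeroˡ _) (∑-representatives rs t g inv distinct covers′)) (+-identityˡ _)

  pairing-as-∑-representatives :
    ∀ rs g → IsoInvariant g → IsoDistinct rs → ∀ x → (∀ {t} → t ∈ map proj₂ x → IsoCovers rs t) →
    pairing x g ≈ ∑[ r ← rs ] (coeff x r * g r)
  pairing-as-∑-representatives rs g inv distinct [] covers = sym (∑-zero rs (λ r _ → zeroˡ _))
  pairing-as-∑-representatives rs g inv distinct ((k , t) ∷ x) covers = begin
      k * g t + pairing x g
    ≈⟨ +-cong (*-congˡ (sym (∑-representatives rs t g inv distinct (covers (here ≡.refl)))))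
              (pairing-as-∑-representatives rs g inv distinct x (λ t∈x → covers (there t∈x))) ⟩
      k * ∑[ r ← rs ] (isoTo r t * g r) + ∑[ r ← rs ] (coeff x r * g r)
    ≈⟨ +-congʳ (*-distribˡ-∑ k rs _) ⟩
      ∑[ r ← rs ] (k * (isoTo r t * g r)) + ∑[ r ← rs ] (coeff x r * g r)
    ≈⟨ ∑-+ rs _ _ ⟨
      ∑[ r ← rs ] (k * (isoTo r t * g r) + coeff x r * g r)
    ≈⟨ ∑-cong rs (λ r → coeff-∷-* r (g r)) ⟨
      ∑[ r ← rs ] (coeff ((k , t) ∷ x) r * g r)
    ∎
    where
    coeff-∷-* : ∀ r m → coeff ((k , t) ∷ x) r * m ≈ k * (isoTo r t * m) + coeff x r * m
    coeff-∷-* r m with isoT t r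
    ... | true = trans (distribʳ _ _ _) (+-congʳ (*-congˡ (sym (*-identityˡ _))))
    ... | false = trans (sym (+-identityˡ _)) (+-congʳ (sym (trans (*-congˡ (zeroˡ _)) (zeroʳ _))))

  pairing-resp-coeff : ∀ g → IsoInvariant g → ∀ x x′ → (∀ u → coeff x u ≈ coeff x′ u) →
                       pairing x g ≈ pairing x′ g
  pairing-resp-coeff g inv x x′ x≋x′ = begin
      pairing x g
    ≈⟨ pairing-as-∑-representatives rs g inv distinct x (λ t∈x → representatives-cover ts (∈.∈-++⁺ˡ t∈x)) ⟩
      ∑[ r ← rs ] (coeff x r * g r)
    ≈⟨ ∑-cong rs (λ r → *-congʳ (x≋x′ r)) ⟩
      ∑[ r ← rs ] (coeff x′ r * g r)
    ≈⟨ pairing-as-∑-representatives rs g inv distinct x′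
         (λ t∈x′ → representatives-cover ts (∈.∈-++⁺ʳ (map proj₂ x) t∈x′)) ⟨
      pairing x′ g
    ∎
    where
    ts = map proj₂ x ++ map proj₂ x′
    rs = representatives ts
    distinct = representatives-distinct ts

  ⇒-resp-coeff : ∀ x x′ y y′ → (∀ u → coeff x u ≈ coeff x′ u) → (∀ u → coeff y u ≈ coeff y′ u) →
                 ∀ u → coeff (x ⇒ y) u ≈ coeff (x′ ⇒ y′) u
  ⇒-resp-coeff x x′ y y′ x≋x′ y≋y′ u = begin
      coeff (x ⇒ y) u
    ≈⟨ coeff-⇒-as-pairing x y u ⟩
      pairing x (graftsWith y)
    ≈⟨ pairing-resp-coeff (graftsWith y) invˡ x x′ x≋x′ ⟩
      pairing x′ (graftsWith y)
    ≈⟨ pairing-cong x′ (λ s → pairing-resp-coeff (λ t → countIso (graftT s t) u) invʳ y y′ y≋y′) ⟩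
      pairing x′ (graftsWith y′)
    ≈⟨ coeff-⇒-as-pairing x′ y′ u ⟨
      coeff (x′ ⇒ y′) u
    ∎
    where
    graftsWith : FSum → PTree D → K
    graftsWith y s = pairing y (λ t → countIso (graftT s t) u)
    invˡ : IsoInvariant (graftsWith y)
    invˡ s s′ s≅s′ = pairing-cong y (λ t → countIso-resp (graftT-resp-≅ (isoT-sound s s′ s≅s′) (≅-refl {t})) u)
    invʳ : ∀ {s} → IsoInvariant (λ t → countIso (graftT s t) u)
    invʳ t t′ t≅t′ = countIso-resp (graftT-resp-≅ ≅-refl (isoT-sound t t′ t≅t′)) u

  coeff-concatMap : ∀ (f : A → FSum) (xs : List A) u → coeff (concatMap f xs) u ≈ ∑[ y ← xs ] coeff (f y) u
  coeff-concatMap f xs u = begin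
      coeff (concatMap f xs) u
    ≈⟨ coeff-as-pairing (concatMap f xs) u ⟩
      pairing (concatMap f xs) (isoTo u)
    ≈⟨ pairing-concatMap f xs (isoTo u) ⟩
      ∑[ y ← xs ] pairing (f y) (isoTo u)
    ≈⟨ ∑-cong xs (λ y → coeff-as-pairing (f y) u) ⟨
      ∑[ y ← xs ] coeff (f y) u
    ∎

  coeff-⊙ : ∀ k x u → coeff (k ⊙ x) u ≈ k * coeff x u
  coeff-⊙ k x u = begin
      coeff (k ⊙ x) u
    ≈⟨ coeff-as-pairing (k ⊙ x) u ⟩
      pairing (k ⊙ x) (isoTo u)
    ≈⟨ pairing-⊙ k x (isoTo u) ⟩
      k * pairing x (isoTo u)
    ≈⟨ *-congˡ (coeff-as-pairing x u) ⟨
      k * coeff x u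
    ∎

  module _ (u : PTree D) where
    private
      graftsWith : FSum → PTree D → K
      graftsWith y s = pairing y (λ t → countIso (graftT s t) u)

    ⇒-concatMapˡ : ∀ (f : A → FSum) (xs : List A) y →
                   coeff (concatMap f xs ⇒ y) u ≈ ∑[ x ← xs ] coeff (f x ⇒ y) u
    ⇒-concatMapˡ f xs y = begin
        coeff (concatMap f xs ⇒ y) u
      ≈⟨ coeff-⇒-as-pairing (concatMap f xs) y u ⟩
        pairing (concatMap f xs) (graftsWith y)
      ≈⟨ pairing-concatMap f xs (graftsWith y) ⟩
        ∑[ x ← xs ] pairing (f x) (graftsWith y)
      ≈⟨ ∑-cong xs (λ x → coeff-⇒-as-pairing (f x) y u) ⟨
        ∑[ x ← xs ] coeff (f x ⇒ y) u
      ∎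

    ⇒-concatMapʳ : ∀ x (f : A → FSum) (ys : List A) →
                   coeff (x ⇒ concatMap f ys) u ≈ ∑[ y ← ys ] coeff (x ⇒ f y) u
    ⇒-concatMapʳ x f ys = begin
        coeff (x ⇒ concatMap f ys) u
      ≈⟨ coeff-⇒-as-pairing x (concatMap f ys) u ⟩
        pairing x (graftsWith (concatMap f ys))
      ≈⟨ pairing-cong x (λ s → pairing-concatMap f ys _) ⟩
        pairing x (λ s → ∑[ y ← ys ] graftsWith (f y) s)
      ≈⟨ pairing-∑ ys x (λ y → graftsWith (f y)) ⟩
        ∑[ y ← ys ] pairing x (graftsWith (f y))
      ≈⟨ ∑-cong ys (λ y → coeff-⇒-as-pairing x (f y) u) ⟨
        ∑[ y ← ys ] coeff (x ⇒ f y) u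
      ∎

    ⇒-⊙ˡ : ∀ k x y → coeff ((k ⊙ x) ⇒ y) u ≈ k * coeff (x ⇒ y) u
    ⇒-⊙ˡ k x y = begin
        coeff ((k ⊙ x) ⇒ y) u
      ≈⟨ coeff-⇒-as-pairing (k ⊙ x) y u ⟩
        pairing (k ⊙ x) (graftsWith y)
      ≈⟨ pairing-⊙ k x (graftsWith y) ⟩
        k * pairing x (graftsWith y)
      ≈⟨ *-congˡ (coeff-⇒-as-pairing x y u) ⟨
        k * coeff (x ⇒ y) u
      ∎

    ⇒-⊙ʳ : ∀ x k y → coeff (x ⇒ (k ⊙ y)) u ≈ k * coeff (x ⇒ y) u
    ⇒-⊙ʳ x k y = begin
        coeff (x ⇒ (k ⊙ y)) u
      ≈⟨ coeff-⇒-as-pairing x (k ⊙ y) u ⟩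
        pairing x (graftsWith (k ⊙ y))
      ≈⟨ pairing-cong x (λ s → pairing-⊙ k y _) ⟩
        pairing x (λ s → k * graftsWith y s)
      ≈⟨ pairing-*ˡ k x (graftsWith y) ⟩
        k * pairing x (graftsWith y)
      ≈⟨ *-congˡ (coeff-⇒-as-pairing x y u) ⟨
        k * coeff (x ⇒ y) u
      ∎

module Graded {c ℓ} (R : CommutativeRing c ℓ) (N : ℕ → ℕ) where
  open Setup R N
  open import Relation.Binary.Reasoning.Setoid setoid
  open ListSum R using (∑; ∑-cong)
  open Coefficients R _≟E_ using (coeff-concatMap; ⇒-resp-coeff)
  open Trees {E}
  open Degree ∣_∣
  open Iso _≟E_ using (isoT)
  open TreeIso _≟E_
  open S using (FSum; coeff; _⊙_; _⇒_; Ψ̄L) renaming (Ψ̄ to Ψ̄E)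

  Homogeneous : ℕ → FSum → Set c
  Homogeneous m x = All (λ p → deg (proj₂ p) ≡ m) x

  deg-isoT : ∀ t u → isoT t u ≡ true → deg t ≡ deg u
  deg-isoT t u t≅u = deg-resp-≅ ∣_∣ (isoT-sound t u t≅u)

  coeff-homog-deg : ∀ m x u → deg u ≡ m → coeff (homog m x) u ≈ coeff x u
  coeff-homog-deg m [] u ∣u∣≡m = refl
  coeff-homog-deg m ((k , t) ∷ x) u ∣u∣≡m with deg t ℕ.≟ m
  ... | yes ∣t∣≡m rewrite List.filter-accept (λ p → deg (proj₂ p) ℕ.≟ m) {k , t} {x} ∣t∣≡m with isoT t u
  ...   | true = +-congˡ (coeff-homog-deg m x u ∣u∣≡m)
  ...   | false = coeff-homog-deg m x u ∣u∣≡m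
  coeff-homog-deg m ((k , t) ∷ x) u ∣u∣≡m | no ∣t∣≢m
    rewrite List.filter-reject (λ p → deg (proj₂ p) ℕ.≟ m) {k , t} {x} ∣t∣≢m with isoT t u in t≅u
  ...   | true = ⊥-elim (∣t∣≢m (≡.trans (deg-isoT t u t≅u) ∣u∣≡m))
  ...   | false = coeff-homog-deg m x u ∣u∣≡m

  coeff-Homogeneous : ∀ m x u → Homogeneous m x → ¬ deg u ≡ m → coeff x u ≈ 0#
  coeff-Homogeneous m [] u _ _ = refl
  coeff-Homogeneous m ((k , t) ∷ x) u (∣t∣≡m ∷ hom) ∣u∣≢m with isoT t u in t≅u
  ... | true = ⊥-elim (∣u∣≢m (≡.trans (≡.sym (deg-isoT t u t≅u)) ∣t∣≡m))
  ... | false = coeff-Homogeneous m x u hom ∣u∣≢m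

  Homogeneous-homog : ∀ m x → Homogeneous m (homog m x)
  Homogeneous-homog m = All.all-filter (λ p → deg (proj₂ p) ℕ.≟ m)

  homog-Homogeneous : ∀ m x → Homogeneous m x → homog m x ≡ x
  homog-Homogeneous m x = List.filter-all (λ p → deg (proj₂ p) ℕ.≟ m)

  coeff-homog : ∀ m x y → Homogeneous m y → (∀ u → coeff x u ≈ coeff y u) →
                ∀ u → coeff (homog m x) u ≈ coeff y u
  coeff-homog m x y hom x≋y u with deg u ℕ.≟ m
  ... | yes ∣u∣≡m = trans (coeff-homog-deg m x u ∣u∣≡m) (x≋y u)
  ... | no ∣u∣≢m = trans (coeff-Homogeneous m (homog m x) u (Homogeneous-homog m x) ∣u∣≢m)
                         (sym (coeff-Homogeneous m y u hom ∣u∣≢m))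

  coeff-homog-resp-≈̂ : ∀ m x x′ → x ≈̂ x′ → ∀ u → coeff (homog m (x m)) u ≈ coeff (homog m (x′ m)) u
  coeff-homog-resp-≈̂ m x x′ x≈x′ u with deg u ℕ.≟ m
  ... | yes ≡.refl = trans (coeff-homog-deg m (x m) u ≡.refl)
                           (trans (x≈x′ u) (sym (coeff-homog-deg m (x′ m) u ≡.refl)))
  ... | no ∣u∣≢m = trans (coeff-Homogeneous m _ u (Homogeneous-homog m (x m)) ∣u∣≢m)
                         (sym (coeff-Homogeneous m _ u (Homogeneous-homog m (x′ m)) ∣u∣≢m))

  Homogeneous-⇒ : ∀ a b x y → Homogeneous a x → Homogeneous b y → Homogeneous (a ℕ.+ b) (x ⇒ y)
  Homogeneous-⇒ a b x y hx hy =
    All-concatMap⁺ _ λ p∈x → All-concatMap⁺ _ λ q∈y → All-map⁺ _ λ v∈grafts →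
      ≡.trans (All.lookup (graftT-deg ∣_∣ _ _) v∈grafts) (cong₂ ℕ._+_ (All.lookup hx p∈x) (All.lookup hy q∈y))

  Homogeneous-⊙ : ∀ m k x → Homogeneous m x → Homogeneous m (k ⊙ x)
  Homogeneous-⊙ m k x hom = All-map⁺ _ (All.lookup hom)

  •[_] : E → FSum
  •[ e ] = (1# , node e []) ∷ []

  mutual
    Homogeneous-Ψ̄ : ∀ t → Homogeneous (deg t) (Ψ̄E t)
    Homogeneous-Ψ̄ (node e ts) = Homogeneous-Ψ̄L-• e ts

    Homogeneous-Ψ̄L-• : ∀ e ts → Homogeneous (∣ e ∣ ℕ.+ degL ts) (Ψ̄L ts •[ e ])
    Homogeneous-Ψ̄L-• e ts =
      ≡.subst (λ n → Homogeneous n (Ψ̄L ts •[ e ]))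
              (≡.trans (cong (degL ts ℕ.+_) (ℕ.+-identityʳ ∣ e ∣)) (ℕ.+-comm (degL ts) ∣ e ∣))
              (Homogeneous-Ψ̄L ts •[ e ] (∣ e ∣ ℕ.+ 0) (≡.refl ∷ []))

    Homogeneous-Ψ̄L : ∀ ts acc m → Homogeneous m acc → Homogeneous (degL ts ℕ.+ m) (Ψ̄L ts acc)
    Homogeneous-Ψ̄L [] acc m hom = hom
    Homogeneous-Ψ̄L (t ∷ ts) acc m hom =
      ≡.subst (λ n → Homogeneous n (Ψ̄L (t ∷ ts) acc)) (≡.sym (ℕ.+-assoc (deg t) (degL ts) m))
        (Homogeneous-⇒ (deg t) (degL ts ℕ.+ m) (Ψ̄E t) (Ψ̄L ts acc) (Homogeneous-Ψ̄ t) (Homogeneous-Ψ̄L ts acc m hom))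

  mutual
    decsT-deg : ∀ t m → All (λ σ → deg σ ≡ m) (decsT t m)
    decsT-deg (node _ ts) m =
      All-concatMap⁺ _ λ {i} i∈upTo → All-concatMap⁺ _ {allFin (N i)} λ {j} _ → All-map⁺ (node (i , j)) λ σs∈decs →
        ≡.trans (cong (suc i ℕ.+_) (All.lookup (decsL-deg ts (m ∸ suc i)) σs∈decs))
                (ℕ.m+[n∸m]≡n (∈.∈-upTo⁻ i∈upTo))

    decsL-deg : ∀ ts m → All (λ σs → degL σs ≡ m) (decsL ts m)
    decsL-deg [] zero = ≡.refl ∷ []
    decsL-deg [] (suc m) = []
    decsL-deg (t ∷ ts) m =
      All-concatMap⁺ _ λ {k} k∈upTo → All-concatMap⁺ _ λ {σ} σ∈decs → All-map⁺ (σ ∷_) λ σs∈decs →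
        ≡.trans (cong₂ ℕ._+_ (All.lookup (decsT-deg t k) σ∈decs) (All.lookup (decsL-deg ts (m ∸ k)) σs∈decs))
                (ℕ.m+[n∸m]≡n (ℕ.≤-pred (∈.∈-upTo⁻ k∈upTo)))

  Homogeneous-rhs : ∀ lam t m → Homogeneous m (rhs lam t m)
  Homogeneous-rhs lam t m = All-concatMap⁺ _ λ {σ} σ∈decs →
    ≡.subst (λ n → Homogeneous n (weight lam σ ⊙ Ψ̄E σ)) (All.lookup (decsT-deg t m) σ∈decs)
            (Homogeneous-⊙ (deg σ) (weight lam σ) (Ψ̄E σ) (Homogeneous-Ψ̄ σ))

  ⇒̂-resp-≈̂ : ∀ x x′ y y′ → x ≈̂ x′ → y ≈̂ y′ → (x ⇒̂ y) ≈̂ (x′ ⇒̂ y′)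
  ⇒̂-resp-≈̂ x x′ y y′ x≈x′ y≈y′ u = begin
      coeff ((x ⇒̂ y) (deg u)) u
    ≈⟨ coeff-concatMap (λ i → homog i (x i) ⇒ homog (deg u ∸ i) (y (deg u ∸ i))) (upTo (suc (deg u))) u ⟩
      ∑[ i ← upTo (suc (deg u)) ] coeff (homog i (x i) ⇒ homog (deg u ∸ i) (y (deg u ∸ i))) u
    ≈⟨ ∑-cong (upTo (suc (deg u))) (λ i →
         ⇒-resp-coeff (homog i (x i)) (homog i (x′ i))
                      (homog (deg u ∸ i) (y (deg u ∸ i))) (homog (deg u ∸ i) (y′ (deg u ∸ i)))
                      (coeff-homog-resp-≈̂ i x x′ x≈x′) (coeff-homog-resp-≈̂ (deg u ∸ i) y y′ y≈y′) u) ⟩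
      ∑[ i ← upTo (suc (deg u)) ] coeff (homog i (x′ i) ⇒ homog (deg u ∸ i) (y′ (deg u ∸ i))) u
    ≈⟨ coeff-concatMap (λ i → homog i (x′ i) ⇒ homog (deg u ∸ i) (y′ (deg u ∸ i))) (upTo (suc (deg u))) u ⟨
      coeff ((x′ ⇒̂ y′) (deg u)) u
    ∎

[m∸n]∸o≡[m∸o]∸n : ∀ m n o → m ∸ n ∸ o ≡ m ∸ o ∸ n
[m∸n]∸o≡[m∸o]∸n m n o =
  ≡.trans (ℕ.∸-+-assoc m n o) (≡.trans (cong (m ∸_) (ℕ.+-comm n o)) (≡.sym (ℕ.∸-+-assoc m o n)))

module Identity {c ℓ} (R : CommutativeRing c ℓ) (N : ℕ → ℕ) where
  open Setup R N
  open import Relation.Binary.Reasoning.Setoid setoid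
  open ListSum R
  open Trees {E}
  open Degree ∣_∣
  open Coefficients R _≟E_
  open Graded R N
  open S using (FSum; coeff; _⊙_; _⇒_; Ψ̄L) renaming (Ψ̄ to Ψ̄E)

  module _ (lam : E → K) where

    -- Σ_δ (Π_v λ_{δ(v)}) Ψ̄(B_+^e(ts_δ)) over the decorations δ of the forest ts of degree m;
    -- the root factor λ_e is left out.
    rootedRhs : E → List (PTree ⊤) → ℕ → FSum
    rootedRhs e ts m = concatMap (λ σs → weightL lam σs ⊙ Ψ̄L σs •[ e ]) (decsL ts m)

    rhsByRoot : List (PTree ⊤) → ℕ → FSum
    rhsByRoot ts d =
      concatMap (λ i → concatMap (λ j → lam (i , j) ⊙ rootedRhs (i , j) ts (d ∸ suc i)) (allFin (N i))) (upTo d)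

    graftRhs : List (PTree ⊤) → PLhat
    graftRhs [] = aSeries lam
    graftRhs (t ∷ ts) = rhs lam t ⇒̂ graftRhs ts

    Homogeneous-rootedRhs : ∀ e ts m → Homogeneous (∣ e ∣ ℕ.+ m) (rootedRhs e ts m)
    Homogeneous-rootedRhs e ts m = All-concatMap⁺ _ λ {σs} σs∈decs →
      Homogeneous-⊙ _ _ _ (≡.subst (λ n → Homogeneous (∣ e ∣ ℕ.+ n) (Ψ̄L σs •[ e ]))
                                   (All.lookup (decsL-deg ts m) σs∈decs) (Homogeneous-Ψ̄L-• e σs))

    Homogeneous-rhsByRoot : ∀ ts d → Homogeneous d (rhsByRoot ts d)
    Homogeneous-rhsByRoot ts d = All-concatMap⁺ _ λ {i} i∈upTo → All-concatMap⁺ _ {allFin (N i)} λ {j} _ →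
      Homogeneous-⊙ _ _ _ (≡.subst (λ n → Homogeneous n (rootedRhs (i , j) ts (d ∸ suc i)))
                                   (ℕ.m+[n∸m]≡n (∈.∈-upTo⁻ i∈upTo)) (Homogeneous-rootedRhs (i , j) ts (d ∸ suc i)))

    coeff-rhsByRoot : ∀ ts d u → coeff (rhsByRoot ts d) u ≈
      ∑[ i ← upTo d ] ∑[ j ← allFin (N i) ] (lam (i , j) * coeff (rootedRhs (i , j) ts (d ∸ suc i)) u)
    coeff-rhsByRoot ts d u =
      trans (coeff-concatMap _ (upTo d) u) (∑-cong (upTo d) λ i →
        trans (coeff-concatMap _ (allFin (N i)) u) (∑-cong (allFin (N i)) λ j →
          coeff-⊙ (lam (i , j)) (rootedRhs (i , j) ts (d ∸ suc i)) u))

    coeff-rootedRhs : ∀ e ts m u → coeff (rootedRhs e ts m) u ≈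
      ∑[ σs ← decsL ts m ] (weightL lam σs * coeff (Ψ̄L σs •[ e ]) u)
    coeff-rootedRhs e ts m u =
      trans (coeff-concatMap _ (decsL ts m) u) (∑-cong (decsL ts m) λ σs →
        coeff-⊙ (weightL lam σs) (Ψ̄L σs •[ e ]) u)

    coeff-rhs-node : ∀ ts d u → coeff (rhs lam (node tt ts) d) u ≈ coeff (rhsByRoot ts d) u
    coeff-rhs-node ts d u = begin
        coeff (rhs lam (node tt ts) d) u
      ≈⟨ coeff-concatMap _ (decsT (node tt ts) d) u ⟩
        ∑[ σ ← decsT (node tt ts) d ] coeff (weight lam σ ⊙ Ψ̄E σ) u
      ≈⟨ ∑-cong (decsT (node tt ts) d) (λ σ → coeff-⊙ (weight lam σ) (Ψ̄E σ) u) ⟩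
        ∑[ σ ← decsT (node tt ts) d ] (weight lam σ * coeff (Ψ̄E σ) u)
      ≈⟨ ∑-concatMap _ (upTo d) _ ⟩
        ∑[ i ← upTo d ] ∑[ σ ← concatMap (λ j → map (node (i , j)) (decsL ts (d ∸ suc i))) (allFin (N i)) ]
          (weight lam σ * coeff (Ψ̄E σ) u)
      ≈⟨ ∑-cong (upTo d) (λ i → trans (∑-concatMap _ (allFin (N i)) _) (∑-cong (allFin (N i)) (λ j →
           sym (byRoot i j)))) ⟩
        ∑[ i ← upTo d ] ∑[ j ← allFin (N i) ] (lam (i , j) * coeff (rootedRhs (i , j) ts (d ∸ suc i)) u)
      ≈⟨ coeff-rhsByRoot ts d u ⟨
        coeff (rhsByRoot ts d) u
      ∎
      where
      byRoot : ∀ i j → lam (i , j) * coeff (rootedRhs (i , j) ts (d ∸ suc i)) u ≈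
                       ∑[ σ ← map (node (i , j)) (decsL ts (d ∸ suc i)) ] (weight lam σ * coeff (Ψ̄E σ) u)
      byRoot i j = begin
          lam (i , j) * coeff (rootedRhs (i , j) ts (d ∸ suc i)) u
        ≈⟨ *-congˡ (coeff-rootedRhs (i , j) ts (d ∸ suc i) u) ⟩
          lam (i , j) * ∑[ σs ← decsL ts (d ∸ suc i) ] (weightL lam σs * coeff (Ψ̄L σs •[ i , j ]) u)
        ≈⟨ *-distribˡ-∑ (lam (i , j)) (decsL ts (d ∸ suc i)) _ ⟩
          ∑[ σs ← decsL ts (d ∸ suc i) ] (lam (i , j) * (weightL lam σs * coeff (Ψ̄L σs •[ i , j ]) u))
        ≈⟨ ∑-cong (decsL ts (d ∸ suc i)) (λ σs → *-assoc _ _ _) ⟨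
          ∑[ σs ← decsL ts (d ∸ suc i) ] (weight lam (node (i , j) σs) * coeff (Ψ̄E (node (i , j) σs)) u)
        ≡⟨ ∑-map (node (i , j)) (decsL ts (d ∸ suc i)) _ ⟨
          ∑[ σ ← map (node (i , j)) (decsL ts (d ∸ suc i)) ] (weight lam σ * coeff (Ψ̄E σ) u)
        ∎

    coeff-rhs⇒rootedRhs : ∀ t k e ts n u → coeff (rhs lam t k ⇒ rootedRhs e ts n) u ≈
      ∑[ σ ← decsT t k ] ∑[ σs ← decsL ts n ] (weight lam σ * (weightL lam σs * coeff (Ψ̄E σ ⇒ Ψ̄L σs •[ e ]) u))
    coeff-rhs⇒rootedRhs t k e ts n u = begin
        coeff (rhs lam t k ⇒ rootedRhs e ts n) u
      ≈⟨ ⇒-concatMapˡ u _ (decsT t k) (rootedRhs e ts n) ⟩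
        ∑[ σ ← decsT t k ] coeff ((weight lam σ ⊙ Ψ̄E σ) ⇒ rootedRhs e ts n) u
      ≈⟨ ∑-cong (decsT t k) (λ σ → ⇒-⊙ˡ u (weight lam σ) (Ψ̄E σ) (rootedRhs e ts n)) ⟩
        ∑[ σ ← decsT t k ] (weight lam σ * coeff (Ψ̄E σ ⇒ rootedRhs e ts n) u)
      ≈⟨ ∑-cong (decsT t k) (λ σ → *-congˡ (trans (⇒-concatMapʳ u (Ψ̄E σ) _ (decsL ts n))
           (∑-cong (decsL ts n) (λ σs → ⇒-⊙ʳ u (Ψ̄E σ) (weightL lam σs) (Ψ̄L σs •[ e ]))))) ⟩
        ∑[ σ ← decsT t k ] (weight lam σ * ∑[ σs ← decsL ts n ] (weightL lam σs * coeff (Ψ̄E σ ⇒ Ψ̄L σs •[ e ]) u))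
      ≈⟨ ∑-cong (decsT t k) (λ σ → *-distribˡ-∑ (weight lam σ) (decsL ts n) _) ⟩
        ∑[ σ ← decsT t k ] ∑[ σs ← decsL ts n ] (weight lam σ * (weightL lam σs * coeff (Ψ̄E σ ⇒ Ψ̄L σs •[ e ]) u))
      ∎

    coeff-rootedRhs-∷ : ∀ e t ts m u → coeff (rootedRhs e (t ∷ ts) m) u ≈
      ∑[ k ← upTo (suc m) ] coeff (rhs lam t k ⇒ rootedRhs e ts (m ∸ k)) u
    coeff-rootedRhs-∷ e t ts m u = begin
        coeff (rootedRhs e (t ∷ ts) m) u
      ≈⟨ coeff-rootedRhs e (t ∷ ts) m u ⟩
        ∑[ σs ← decsL (t ∷ ts) m ] W σs
      ≈⟨ ∑-concatMap (λ k → concatMap (λ σ → map (σ ∷_) (decsL ts (m ∸ k))) (decsT t k)) (upTo (suc m)) W ⟩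
        ∑[ k ← upTo (suc m) ] ∑[ σs ← concatMap (λ σ → map (σ ∷_) (decsL ts (m ∸ k))) (decsT t k) ] W σs
      ≈⟨ ∑-cong (upTo (suc m)) (λ k → trans (∑-concatMap _ (decsT t k) W) (∑-cong (decsT t k) (λ σ →
           trans (reflexive (∑-map (σ ∷_) (decsL ts (m ∸ k)) W))
                 (∑-cong (decsL ts (m ∸ k)) (λ σs → *-assoc _ _ _))))) ⟩
        ∑[ k ← upTo (suc m) ] ∑[ σ ← decsT t k ] ∑[ σs ← decsL ts (m ∸ k) ]
          (weight lam σ * (weightL lam σs * coeff (Ψ̄E σ ⇒ Ψ̄L σs •[ e ]) u))
      ≈⟨ ∑-cong (upTo (suc m)) (λ k → coeff-rhs⇒rootedRhs t k e ts (m ∸ k) u) ⟨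
        ∑[ k ← upTo (suc m) ] coeff (rhs lam t k ⇒ rootedRhs e ts (m ∸ k)) u
      ∎
      where
      W : List (PTree E) → K
      W σs = weightL lam σs * coeff (Ψ̄L σs •[ e ]) u

    coeff-rootedRhs-leaf : ∀ e u → coeff (rootedRhs e [] 0) u ≈ isoTo u (node e [])
    coeff-rootedRhs-leaf e u = begin
        coeff (rootedRhs e [] 0) u
      ≈⟨ coeff-rootedRhs e [] 0 u ⟩
        1# * coeff •[ e ] u + 0#
      ≈⟨ trans (+-identityʳ _) (*-identityˡ _) ⟩
        coeff •[ e ] u
      ≈⟨ coeff-as-pairing •[ e ] u ⟩
        1# * isoTo u (node e []) + 0#
      ≈⟨ trans (+-identityʳ _) (*-identityˡ _) ⟩
        isoTo u (node e [])
      ∎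

    coeff-rootedRhs-[] : ∀ e m u → 0 ℕ.< m → coeff (rootedRhs e [] m) u ≈ 0#
    coeff-rootedRhs-[] e (suc m) u _ = refl

    coeff-aSeries : ∀ d u → coeff (aSeries lam d) u ≈ coeff (rhsByRoot [] d) u
    coeff-aSeries zero u = refl
    coeff-aSeries (suc d) u = begin
        coeff (aSeries lam (suc d)) u
      ≈⟨ coeff-as-pairing (aSeries lam (suc d)) u ⟩
        pairing (aSeries lam (suc d)) (isoTo u)
      ≡⟨ ∑-map _ (allFin (N d)) _ ⟩
        ∑[ j ← allFin (N d) ] (lam (d , j) * isoTo u (node (d , j) []))
      ≈⟨ ∑-cong (allFin (N d)) (λ j → *-congˡ (coeff-rootedRhs-leaf (d , j) u)) ⟨
        ∑[ j ← allFin (N d) ] (lam (d , j) * coeff (rootedRhs (d , j) [] 0) u)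
      ≡⟨ cong (λ n → ∑[ j ← allFin (N d) ] (lam (d , j) * coeff (rootedRhs (d , j) [] n) u)) (ℕ.n∸n≡0 d) ⟨
        byRoot d
      ≈⟨ +-identityˡ _ ⟨
        0# + byRoot d
      ≈⟨ +-congʳ (∑<-zero d (λ i i<d → ∑-zero (allFin (N i)) (λ j _ →
           trans (*-congˡ (coeff-rootedRhs-[] (i , j) (d ∸ i) u (ℕ.m<n⇒0<n∸m i<d))) (zeroʳ _)))) ⟨
        ∑< d byRoot + byRoot d
      ≈⟨ ∑<-last d byRoot ⟨
        ∑< (suc d) byRoot
      ≡⟨ ∑-upTo (suc d) byRoot ⟨
        ∑[ i ← upTo (suc d) ] byRoot i
      ≈⟨ coeff-rhsByRoot [] (suc d) u ⟨
        coeff (rhsByRoot [] (suc d)) u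
      ∎
      where
      byRoot : ℕ → K
      byRoot i = ∑[ j ← allFin (N i) ] (lam (i , j) * coeff (rootedRhs (i , j) [] (d ∸ i)) u)

    coeff-rhs⇒rhsByRoot : ∀ t k ts n u → coeff (rhs lam t k ⇒ rhsByRoot ts n) u ≈
      ∑[ i ← upTo n ] ∑[ j ← allFin (N i) ] (lam (i , j) * coeff (rhs lam t k ⇒ rootedRhs (i , j) ts (n ∸ suc i)) u)
    coeff-rhs⇒rhsByRoot t k ts n u =
      trans (⇒-concatMapʳ u (rhs lam t k) _ (upTo n)) (∑-cong (upTo n) λ i →
        trans (⇒-concatMapʳ u (rhs lam t k) _ (allFin (N i))) (∑-cong (allFin (N i)) λ j →
          ⇒-⊙ʳ u (rhs lam t k) (lam (i , j)) (rootedRhs (i , j) ts (n ∸ suc i))))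

    coeff-rootedRhs-∷-byRoot : ∀ t ts d i u →
      ∑[ j ← allFin (N i) ] (lam (i , j) * coeff (rootedRhs (i , j) (t ∷ ts) (d ∸ suc i)) u) ≈
      ∑[ k ← upTo (suc (d ∸ suc i)) ] ∑[ j ← allFin (N i) ]
        (lam (i , j) * coeff (rhs lam t k ⇒ rootedRhs (i , j) ts (d ∸ k ∸ suc i)) u)
    coeff-rootedRhs-∷-byRoot t ts d i u = begin
        ∑[ j ← allFin (N i) ] (lam (i , j) * coeff (rootedRhs (i , j) (t ∷ ts) (d ∸ suc i)) u)
      ≈⟨ ∑-cong (allFin (N i)) (λ j → trans (*-congˡ (coeff-rootedRhs-∷ (i , j) t ts (d ∸ suc i) u))
                                            (*-distribˡ-∑ (lam (i , j)) ks _)) ⟩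
        ∑[ j ← allFin (N i) ] ∑[ k ← ks ] (lam (i , j) * coeff (rhs lam t k ⇒ rootedRhs (i , j) ts (d ∸ suc i ∸ k)) u)
      ≈⟨ ∑-comm (allFin (N i)) ks _ ⟩
        ∑[ k ← ks ] ∑[ j ← allFin (N i) ] (lam (i , j) * coeff (rhs lam t k ⇒ rootedRhs (i , j) ts (d ∸ suc i ∸ k)) u)
      ≈⟨ ∑-cong ks (λ k → ∑-cong (allFin (N i)) (λ j → reflexive (cong
           (λ n → lam (i , j) * coeff (rhs lam t k ⇒ rootedRhs (i , j) ts n) u) ([m∸n]∸o≡[m∸o]∸n d (suc i) k)))) ⟩
        ∑[ k ← ks ] ∑[ j ← allFin (N i) ] (lam (i , j) * coeff (rhs lam t k ⇒ rootedRhs (i , j) ts (d ∸ k ∸ suc i)) u)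
      ∎
      where
      ks = upTo (suc (d ∸ suc i))

    coeff-graftRhs : ∀ ts d u → coeff (graftRhs ts d) u ≈ coeff (rhsByRoot ts d) u
    coeff-graftRhs [] d u = coeff-aSeries d u
    coeff-graftRhs (t ∷ ts) d u = begin
        coeff (graftRhs (t ∷ ts) d) u
      ≈⟨ coeff-concatMap (λ k → homog k (rhs lam t k) ⇒ homog (d ∸ k) (graftRhs ts (d ∸ k))) (upTo (suc d)) u ⟩
        ∑[ k ← upTo (suc d) ] coeff (homog k (rhs lam t k) ⇒ homog (d ∸ k) (graftRhs ts (d ∸ k))) u
      ≈⟨ ∑-cong (upTo (suc d)) (λ k → ⇒-resp-coeff (homog k (rhs lam t k)) (rhs lam t k)
           (homog (d ∸ k) (graftRhs ts (d ∸ k))) (rhsByRoot ts (d ∸ k)) (homog-rhs k) (homog-graftRhs (d ∸ k)) u) ⟩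
        ∑[ k ← upTo (suc d) ] coeff (rhs lam t k ⇒ rhsByRoot ts (d ∸ k)) u
      ≈⟨ ∑-cong (upTo (suc d)) (λ k → coeff-rhs⇒rhsByRoot t k ts (d ∸ k) u) ⟩
        ∑[ k ← upTo (suc d) ] ∑[ i ← upTo (d ∸ k) ] term k i
      ≈⟨ ∑-upTo-triangle d term ⟩
        ∑[ i ← upTo d ] ∑[ k ← upTo (suc (d ∸ suc i)) ] term k i
      ≈⟨ ∑-cong (upTo d) (λ i → coeff-rootedRhs-∷-byRoot t ts d i u) ⟨
        ∑[ i ← upTo d ] ∑[ j ← allFin (N i) ] (lam (i , j) * coeff (rootedRhs (i , j) (t ∷ ts) (d ∸ suc i)) u)
      ≈⟨ coeff-rhsByRoot (t ∷ ts) d u ⟨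
        coeff (rhsByRoot (t ∷ ts) d) u
      ∎
      where
      homog-rhs : ∀ k v → coeff (homog k (rhs lam t k)) v ≈ coeff (rhs lam t k) v
      homog-rhs k v = reflexive (cong (λ x → coeff x v) (homog-Homogeneous k (rhs lam t k) (Homogeneous-rhs lam t k)))
      homog-graftRhs : ∀ n v → coeff (homog n (graftRhs ts n)) v ≈ coeff (rhsByRoot ts n) v
      homog-graftRhs n = coeff-homog n (graftRhs ts n) (rhsByRoot ts n) (Homogeneous-rhsByRoot ts n) (coeff-graftRhs ts n)
      term : ℕ → ℕ → K
      term k i = ∑[ j ← allFin (N i) ] (lam (i , j) * coeff (rhs lam t k ⇒ rootedRhs (i , j) ts (d ∸ k ∸ suc i)) u)

    graftRhs-rhs : ∀ ts → graftRhs ts ≈̂ rhs lam (node tt ts)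
    graftRhs-rhs ts u = trans (coeff-graftRhs ts (deg u) u) (sym (coeff-rhs-node ts (deg u) u))

module _ {c ℓ} (R : CommutativeRing c ℓ) (N : ℕ → ℕ) where
  open Setup R N
  open Graded R N using (⇒̂-resp-≈̂)
  open Identity R N

  module _ (lam : E → K) (G : PL• → PLhat) (G-hom : IsPreLieHom G) (G•≈a : G • ≈̂ aSeries lam) where
    open IsPreLieHom G-hom

    mutual
      G-Ψ̄ : ∀ τ → G (Ψ̄• τ) ≈̂ rhs lam τ
      G-Ψ̄ (node tt ts) u = trans (G-Ψ̄L ts u) (graftRhs-rhs lam ts u)

      G-Ψ̄L : ∀ ts → G (U.Ψ̄L ts •) ≈̂ graftRhs lam ts
      G-Ψ̄L [] = G•≈a
      G-Ψ̄L (t ∷ ts) u = trans (G-graft (Ψ̄• t) (U.Ψ̄L ts •) u)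
        (⇒̂-resp-≈̂ (G (Ψ̄• t)) (rhs lam t) (G (U.Ψ̄L ts •)) (graftRhs lam ts) (G-Ψ̄ t) (G-Ψ̄L ts) u)

mainTheorem5 : ∀ {c ℓ} (R : CommutativeRing c ℓ) (N : ℕ → ℕ) →
    let open Setup R N in
    IsField →
    (lam : E → K) →
    (G : PL• → PLhat) → IsPreLieHom G → G • ≈̂ aSeries lam →
    (τ : PTree ⊤) → G (Ψ̄• τ) ≈̂ rhs lam τ
mainTheorem5 R N _ lam G G-hom G•≈a = G-Ψ̄ R N lam G G-hom G•≈a
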